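{- Let $n\ge 4$ be even and let $\mathcal{F}=\{F_0,\ldots,F_{n+2}\}$ with $F_0=[n]$, $F_i=[n]\setminus\{i\}$ for $1\le i\le n$, $F_{n+1}=[n]\setminus\{1,2\}$, $F_{n+2}=[n]\setminus\{3,4\}$. Let $\mathcal{S}=\{S_0,\ldots,S_{n+2}\}\subseteq\mathcal{P}([n])$ be a family that satisfies Reimer's conditions via $\mathcal{F}$ and the bijection $S_i\mapsto F_i$, and suppose $\mathcal{S}$ does not satisfy the abundance condition. Let $x$ be the smallest size of a member of $\mathcal{S}$. Then $n\ge 4x+4$.
   Context: $[n]=\{1,\ldots,n\}$. For $A\subseteq B\subseteq[n]$, $[A,B]=\{C: A\subseteq C\subseteq B\}$. A family $\mathcal{F}\subseteq\mathcal{P}([n])$ is a filter if $F\in\mathcal{F}$ and $i\in[n]$ imply $F\cup\{i\}\in\mathcal{F}$ (the $\mathcal{F}$ above is a filter). $\mathcal{S}$ satisfies Reimer's conditions via $\mathcal{F}$ and a bijection $A\mapsto F_A$ from $\mathcal{S}$ to $\mathcal{F}$ if (1) $A\subseteq F_A$ for all $A\in\mathcal{S}$, and (2) for distinct $A,B\in\mathcal{S}$, $[A,F_A]\cap[B,F_B]=\emptyset$. A family satisfies the abundance condition if some element belongs to at least half of its member sets. -}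

module Defs where

open import Data.Nat using (ℕ; zero; suc; _+_; _*_; _≤_; _<_; _≡ᵇ_; _≤ᵇ_)
open import Data.Bool using (Bool; true; false; not; _∨_; if_then_else_)
open import Data.Fin using (Fin; toℕ)
open import Data.Fin.Subset using (Subset; _∈_; _⊆_; ∣_∣)
open import Data.Fin.Subset.Properties using (_∈?_)
open import Data.Vec using (tabulate)
open import Data.List using (List; length; filter; allFin)
open import Data.Product using (Σ; ∃; _×_)
open import Relation.Nullary using (¬_)
open import Relation.Binary.PropositionalEquality using (_≡_)

-- Element e : Fin n of the ground set represents the integer toℕ e + 1 ∈ [n].
-- inF n k m : whether the (1-based) element m belongs to F_k.
inF : ℕ → ℕ → ℕ → Bool
inF n k m =
  if k ≡ᵇ 0 then true
  else if k ≤ᵇ n then not (m ≡ᵇ k)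
  else if k ≡ᵇ suc n then not ((m ≡ᵇ 1) ∨ (m ≡ᵇ 2))
  else not ((m ≡ᵇ 3) ∨ (m ≡ᵇ 4))

F : (n : ℕ) → Fin (n + 3) → Subset n
F n i = tabulate (λ e → inF n (toℕ i) (suc (toℕ e)))

IntervalsDisjoint : ∀ {n} → Subset n → Subset n → Subset n → Subset n → Set
IntervalsDisjoint {n} A B C D =
  ¬ (Σ (Subset n) λ X → (A ⊆ X × X ⊆ B) × (C ⊆ X × X ⊆ D))

-- Reimer's conditions for the family S (indexed by Fin m, assumed injective,
-- i.e. the map S i ↦ G i is a bijection onto the family G).
Reimer : ∀ {n m} → (Fin m → Subset n) → (Fin m → Subset n) → Set
Reimer {n} {m} S G =
  (∀ i → S i ⊆ G i) ×
  (∀ i j → ¬ (i ≡ j) → IntervalsDisjoint (S i) (G i) (S j) (G j))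

degree : ∀ {n m} → (Fin m → Subset n) → Fin n → ℕ
degree {n} {m} S e = length (filter (λ i → e ∈? S i) (allFin m))

Abundant : ∀ {n m} → (Fin m → Subset n) → Set
Abundant {n} {m} S = ∃ λ (e : Fin n) → m ≤ 2 * degree S e

{-# OPTIONS --safe #-}
-- S₀ = [n], since an element e ∉ S₀ would put F_e into both [S₀, F₀] and [S_e, F_e].
-- For distinct e, e′ ∈ [n], e′ ∈ S_e or e ∈ S_e′, since otherwise S_e ∪ S_e′ lies in both
-- intervals; for {1,2} and {3,4} both hold, since e.g. 2 ∉ S₁ gives S₁ ⊆ F_{n+1} ⊆ F₁.
-- Counting these memberships, ∑_{e ∈ [n]} |S_e| ≥ (n² − n)/2 + 2. Without abundance every
-- element lies in at most (n + 2)/2 members, so n + ∑_e |S_e| + |S_{n+1}| + |S_{n+2}| ≤ n(n + 2)/2,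
-- and |S_{n+1}|, |S_{n+2}| ≥ x leaves 4x + 4 ≤ n.
module Submission where

open import Defs
open import Data.Nat using (ℕ; _+_; _*_; _≤_)
open import Data.Nat.Divisibility using (_∣_)
open import Data.Fin using (Fin)
open import Data.Fin.Subset using (Subset; ∣_∣)
open import Data.Product using (∃)
open import Function.Definitions using (Injective)
open import Relation.Nullary using (¬_)
open import Relation.Binary.PropositionalEquality using (_≡_)

open import Data.Bool using (true; false; not; _∨_; if_then_else_; T)
open import Data.Bool.Properties using (T-≡)
open import Data.Empty using (⊥-elim)
open import Data.Fin using (suc; toℕ; cast; _↑ˡ_; _↑ʳ_)
open import Data.Fin.Patterns using (0F; 1F; 2F; 3F)
open import Data.Fin.Properties
  using (_≟_; toℕ-cast; cast-is-id; toℕ-↑ˡ; toℕ-↑ʳ; toℕ-injective; toℕ<n)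
open import Data.Fin.Subset using (_∈_; _∉_; _⊆_; _∪_; ⊤)
open import Data.Fin.Subset.Properties
  using (_∈?_; p⊆p∪q; q⊆p∪q; x∈p∪q⁻; ⊆-refl; ∣⊤∣≡n; p⊆q⇒∣p∣≤∣q∣)
open import Data.List using (length; filter)
import Data.List as List
open import Data.Nat as ℕ using (zero; suc; z≤n; s≤s; _<_; _≡ᵇ_; _<ᵇ_)
open import Data.Nat.Properties
  using ( +-0-commutativeMonoid; +-*-semiring; +-assoc; +-comm; +-identityʳ; +-suc; suc-injective
        ; +-mono-≤; +-monoˡ-≤; +-mono-<-≤; +-mono-≤-<; +-cancelˡ-≤; m≤n+m; ≰⇒>; <⇒≢; m<n⇒m<1+n
        ; n<1+n; n≮n; <-asym; 1+n≢n; 0≢1+n; <⇒<ᵇ; <ᵇ⇒<; ≡⇒≡ᵇ; ≡ᵇ⇒≡; module ≤-Reasoning )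
open import Algebra.Properties.CommutativeMonoid.Sum +-0-commutativeMonoid
  using (sum; sum-syntax; sum-cong-≗; sum-replicate-zero; ∑-distrib-+; ∑-comm)
open import Algebra.Properties.Semiring.Sum +-*-semiring using (*-distribˡ-sum)
open import Data.Nat.Tactic.RingSolver using (solve-∀)
open import Data.Product using (_×_; _,_; proj₁; proj₂)
open import Data.Sum using (_⊎_; inj₁; inj₂)
open import Data.Vec using ([]; _∷_)
open import Data.Vec.Functional using (Vector)
open import Data.Vec.Properties using (lookup∘tabulate; []=⇒lookup; lookup⇒[]=)
open import Function using (_∘_; _⇔_; mk⇔; Equivalence)
open import Function.Properties.Equivalence using () renaming (trans to ⇔-trans)
open import Relation.Nullary using (Dec; yes; no; does; contradiction)
open import Relation.Nullary.Decidable using (dec-true; dec-false; decidable-stable)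
open import Relation.Unary using (Pred; Decidable)
open import Relation.Binary.PropositionalEquality
  using (_≢_; refl; sym; trans; cong; cong₂; subst; module ≡-Reasoning)

open Equivalence using (to; from)

𝟙 : ∀ {p} {P : Set p} → Dec P → ℕ
𝟙 P? = if does P? then 1 else 0

𝟙-yes : ∀ {p} {P : Set p} {P? : Dec P} → P → 𝟙 P? ≡ 1
𝟙-yes {P? = P?} p rewrite dec-true P? p = refl

∑-const : ∀ n c → ∑[ i < n ] c ≡ n * c
∑-const zero    c = refl
∑-const (suc n) c = cong (c +_) (∑-const n c)

∑-one : ∀ n → ∑[ i < n ] 1 ≡ n
∑-one zero    = refl
∑-one (suc n) = cong suc (∑-one n)

∑-mono-≤ : ∀ {n} {f g : Vector ℕ n} → (∀ i → f i ≤ g i) → sum f ≤ sum g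
∑-mono-≤ {zero}  f≤g = z≤n
∑-mono-≤ {suc n} f≤g = +-mono-≤ (f≤g 0F) (∑-mono-≤ (f≤g ∘ suc))

∑-mono-< : ∀ {n} {f g : Vector ℕ n} (i : Fin n) → (∀ j → f j ≤ g j) → f i < g i → sum f < sum g
∑-mono-< 0F      f≤g fi<gi = +-mono-<-≤ fi<gi (∑-mono-≤ (f≤g ∘ suc))
∑-mono-< (suc i) f≤g fi<gi = +-mono-≤-< (f≤g 0F) (∑-mono-< i (f≤g ∘ suc) fi<gi)

∑-↑ : ∀ a {b} (f : Vector ℕ (a + b)) → sum f ≡ ∑[ i < a ] f (i ↑ˡ b) + ∑[ j < b ] f (a ↑ʳ j)
∑-↑ zero    f = refl
∑-↑ (suc a) f = trans (cong (f 0F +_) (∑-↑ a (f ∘ suc))) (sym (+-assoc (f 0F) _ _))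

∑-cast : ∀ {m n} (m≡n : m ≡ n) (f : Vector ℕ n) → sum f ≡ sum (f ∘ cast m≡n)
∑-cast refl f = sum-cong-≗ (cong f ∘ sym ∘ cast-is-id refl)

∑-𝟙≟ : ∀ {n} (i : Fin n) → ∑[ j < n ] 𝟙 (i ≟ j) ≡ 1
∑-𝟙≟ {suc n} 0F      = cong suc (sum-replicate-zero n)
∑-𝟙≟ {suc n} (suc i) = ∑-𝟙≟ i

∑∑-symmetrised : ∀ {n} (M : Fin n → Fin n → ℕ) →
  ∑[ i < n ] ∑[ j < n ] (𝟙 (i ≟ j) + (M i j + M j i)) ≡
  n + (∑[ i < n ] ∑[ j < n ] M i j + ∑[ i < n ] ∑[ j < n ] M i j)
∑∑-symmetrised {n} M = begin
  ∑[ i < n ] ∑[ j < n ] (𝟙 (i ≟ j) + (M i j + M j i))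
    ≡⟨ sum-cong-≗ row ⟩
  ∑[ i < n ] (1 + (∑[ j < n ] M i j + ∑[ j < n ] M j i))
    ≡⟨ ∑-distrib-+ (λ _ → 1) (λ i → ∑[ j < n ] M i j + ∑[ j < n ] M j i) ⟩
  ∑[ i < n ] 1 + ∑[ i < n ] (∑[ j < n ] M i j + ∑[ j < n ] M j i)
    ≡⟨ cong₂ _+_ (∑-one n) (∑-distrib-+ (λ i → ∑[ j < n ] M i j) (λ i → ∑[ j < n ] M j i)) ⟩
  n + (∑[ i < n ] ∑[ j < n ] M i j + ∑[ i < n ] ∑[ j < n ] M j i)
    ≡⟨ cong (λ t → n + (∑[ i < n ] ∑[ j < n ] M i j + t)) (∑-comm (λ i j → M j i)) ⟩
  n + (∑[ i < n ] ∑[ j < n ] M i j + ∑[ i < n ] ∑[ j < n ] M i j) ∎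
  where
  open ≡-Reasoning
  row : ∀ i → ∑[ j < n ] (𝟙 (i ≟ j) + (M i j + M j i)) ≡ 1 + (∑[ j < n ] M i j + ∑[ j < n ] M j i)
  row i = trans (∑-distrib-+ (λ j → 𝟙 (i ≟ j)) (λ j → M i j + M j i))
                (cong₂ _+_ (∑-𝟙≟ i) (∑-distrib-+ (M i) (λ j → M j i)))

∣p∣≡∑𝟙∈ : ∀ {n} (p : Subset n) → ∣ p ∣ ≡ ∑[ x < n ] 𝟙 (x ∈? p)
∣p∣≡∑𝟙∈ []          = refl
∣p∣≡∑𝟙∈ (true ∷ p)  = cong suc (∣p∣≡∑𝟙∈ p)
∣p∣≡∑𝟙∈ (false ∷ p) = ∣p∣≡∑𝟙∈ p

length-filter-tabulate : ∀ {a p n} {A : Set a} {P : Pred A p} (P? : Decidable P) (f : Fin n → A) →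
  length (filter P? (List.tabulate f)) ≡ ∑[ i < n ] 𝟙 (P? (f i))
length-filter-tabulate {n = zero}  P? f = refl
length-filter-tabulate {n = suc n} P? f with does (P? (f 0F))
... | true  = cong suc (length-filter-tabulate P? (f ∘ suc))
... | false = length-filter-tabulate P? (f ∘ suc)

∑-degree : ∀ {n m} (S : Fin m → Subset n) → ∑[ x < n ] degree S x ≡ ∑[ i < m ] ∣ S i ∣
∑-degree {n} {m} S = begin
  ∑[ x < n ] degree S x              ≡⟨ sum-cong-≗ (λ x → length-filter-tabulate ((x ∈?_) ∘ S) (λ i → i)) ⟩
  ∑[ x < n ] ∑[ i < m ] 𝟙 (x ∈? S i) ≡⟨ ∑-comm (λ x i → 𝟙 (x ∈? S i)) ⟩
  ∑[ i < m ] ∑[ x < n ] 𝟙 (x ∈? S i) ≡⟨ sum-cong-≗ (sym ∘ ∣p∣≡∑𝟙∈ ∘ S) ⟩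
  ∑[ i < m ] ∣ S i ∣                 ∎
  where open ≡-Reasoning

¬Abundant⇒∑degree≤ : ∀ {n m} (S : Fin m → Subset n) → ¬ Abundant S →
  n + 2 * ∑[ x < n ] degree S x ≤ n * m
¬Abundant⇒∑degree≤ {n} {m} S ¬abundant = begin
  n + 2 * ∑[ x < n ] degree S x
    ≡⟨ cong₂ _+_ (sym (∑-one n)) (*-distribˡ-sum 2 (degree S)) ⟩
  ∑[ x < n ] 1 + ∑[ x < n ] (2 * degree S x)
    ≡⟨ ∑-distrib-+ (λ _ → 1) (λ x → 2 * degree S x) ⟨
  ∑[ x < n ] (1 + 2 * degree S x)
    ≤⟨ ∑-mono-≤ (λ x → ≰⇒> (λ m≤ → ¬abundant (x , m≤))) ⟩
  ∑[ x < n ] m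
    ≡⟨ ∑-const n m ⟩
  n * m ∎
  where open ≤-Reasoning

module _ {n m} {S G : Fin m → Subset n} where

  Reimer⇒∈ : Reimer S G → ∀ {i j a} →
    i ≢ j → G j ⊆ G i → (∀ {x} → x ∈ G i → x ≢ a → x ∈ G j) → a ∈ S i
  Reimer⇒∈ (S⊆G , disjoint) {i} {j} {a} i≢j Gj⊆Gi Gi∖a⊆Gj = decidable-stable (a ∈? S i) λ a∉Si →
    disjoint i j i≢j (G j , (Si⊆Gj a∉Si , Gj⊆Gi) , (S⊆G j , ⊆-refl))
    where
    Si⊆Gj : a ∉ S i → S i ⊆ G j
    Si⊆Gj a∉Si x∈Si = Gi∖a⊆Gj (S⊆G i x∈Si) (λ { refl → a∉Si x∈Si })

  Reimer⇒∈⊎∈ : Reimer S G → ∀ {i j a b} →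
    i ≢ j → (∀ {x} → x ≢ a → x ∈ G i) → (∀ {x} → x ≢ b → x ∈ G j) → b ∈ S i ⊎ a ∈ S j
  Reimer⇒∈⊎∈ (S⊆G , disjoint) {i} {j} {a} {b} i≢j Gi⊇ Gj⊇ with b ∈? S i | a ∈? S j
  ... | yes b∈Si | _        = inj₁ b∈Si
  ... | no _     | yes a∈Sj = inj₂ a∈Sj
  ... | no b∉Si  | no a∉Sj  =
    ⊥-elim (disjoint i j i≢j (S i ∪ S j , (p⊆p∪q (S j) , ∪⊆Gi) , (q⊆p∪q (S i) (S j) , ∪⊆Gj)))
    where
    ∪⊆Gi : S i ∪ S j ⊆ G i
    ∪⊆Gi x∈ with x∈p∪q⁻ (S i) (S j) x∈
    ... | inj₁ x∈Si = S⊆G i x∈Si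
    ... | inj₂ x∈Sj = Gi⊇ (λ { refl → a∉Sj x∈Sj })
    ∪⊆Gj : S i ∪ S j ⊆ G j
    ∪⊆Gj x∈ with x∈p∪q⁻ (S i) (S j) x∈
    ... | inj₁ x∈Si = Gj⊇ (λ { refl → b∉Si x∈Si })
    ... | inj₂ x∈Sj = S⊆G j x∈Sj

inF-single : ∀ {n k} j → k < n → inF n (suc k) j ≡ not (j ≡ᵇ suc k)
inF-single {n} {k} j k<n with k <ᵇ n | <⇒<ᵇ k<n
... | true  | _  = refl
... | false | ()

inF-pair₁₂ : ∀ n j → inF n (suc n) j ≡ not ((j ≡ᵇ 1) ∨ (j ≡ᵇ 2))
inF-pair₁₂ n j with n <ᵇ n | <ᵇ⇒< n n | n ≡ᵇ n | ≡⇒≡ᵇ n n refl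
... | true  | n<n | _     | _  = contradiction (n<n _) (n≮n n)
... | false | _   | true  | _  = refl
... | false | _   | false | ()

inF-pair₃₄ : ∀ n j → inF n (2 + n) j ≡ not ((j ≡ᵇ 3) ∨ (j ≡ᵇ 4))
inF-pair₃₄ n j with suc n <ᵇ n | <ᵇ⇒< (suc n) n | suc n ≡ᵇ n | ≡ᵇ⇒≡ (suc n) n
... | true  | 1+n<n | _     | _     = contradiction (1+n<n _) (<-asym (n<1+n n))
... | false | _     | true  | 1+n≡n = contradiction (1+n≡n _) 1+n≢n
... | false | _     | false | _     = refl

T-not-≡ᵇ⇔≢ : ∀ {m n} → T (not (m ≡ᵇ n)) ⇔ m ≢ n
T-not-≡ᵇ⇔≢ {m} {n} = mk⇔
  (λ { t refl → subst (T ∘ not) (dec-true (m ℕ.≟ m) refl) t })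
  (λ m≢n → subst (T ∘ not) (sym (dec-false (m ℕ.≟ n) m≢n)) _)

T-not-0∨1⇔ : ∀ {m} (x : Fin (2 + m)) → T (not ((toℕ x ≡ᵇ 0) ∨ (toℕ x ≡ᵇ 1))) ⇔ (x ≢ 0F × x ≢ 1F)
T-not-0∨1⇔ 0F            = mk⇔ (λ ()) (λ (0≢0 , _) → 0≢0 refl)
T-not-0∨1⇔ 1F            = mk⇔ (λ ()) (λ (_ , 1≢1) → 1≢1 refl)
T-not-0∨1⇔ (suc (suc _)) = mk⇔ (λ _ → (λ ()) , (λ ())) _

T-not-2∨3⇔ : ∀ {m} (x : Fin (4 + m)) → T (not ((toℕ x ≡ᵇ 2) ∨ (toℕ x ≡ᵇ 3))) ⇔ (x ≢ 2F × x ≢ 3F)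
T-not-2∨3⇔ 0F                        = mk⇔ (λ _ → (λ ()) , (λ ())) _
T-not-2∨3⇔ 1F                        = mk⇔ (λ _ → (λ ()) , (λ ())) _
T-not-2∨3⇔ 2F                        = mk⇔ (λ ()) (λ (2≢2 , _) → 2≢2 refl)
T-not-2∨3⇔ 3F                        = mk⇔ (λ ()) (λ (_ , 3≢3) → 3≢3 refl)
T-not-2∨3⇔ (suc (suc (suc (suc _)))) = mk⇔ (λ _ → (λ ()) , (λ ())) _

module Family (n : ℕ) where

  ∈F⇔ : ∀ {i : Fin (n + 3)} {k x b} → toℕ i ≡ k → inF n k (suc (toℕ x)) ≡ b → x ∈ F n i ⇔ T b
  ∈F⇔ {x = x} refl refl = mk⇔
    (λ x∈ → from T-≡ (trans (sym (lookup∘tabulate _ x)) ([]=⇒lookup x∈)))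
    (λ t → lookup⇒[]= x _ (trans (lookup∘tabulate _ x) (to T-≡ t)))

  index : Fin (suc (n + 2)) → Fin (n + 3)
  index = cast (sym (+-suc n 2))

  -- ι e is the index of F_{e+1} = [n] ∖ {e+1}; ι₁₂ and ι₃₄ are those of F_{n+1} and F_{n+2}.
  ι : Fin n → Fin (n + 3)
  ι e = index (suc (e ↑ˡ 2))

  ι₀ ι₁₂ ι₃₄ : Fin (n + 3)
  ι₀  = index 0F
  ι₁₂ = index (suc (n ↑ʳ 0F))
  ι₃₄ = index (suc (n ↑ʳ 1F))

  ∑-indices : (f : Fin (n + 3) → ℕ) →
    ∑[ i < n + 3 ] f i ≡ f ι₀ + (∑[ e < n ] f (ι e) + (f ι₁₂ + f ι₃₄))
  ∑-indices f = begin
    ∑[ i < n + 3 ] f i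
      ≡⟨ ∑-cast (sym (+-suc n 2)) f ⟩
    f ι₀ + ∑[ j < n + 2 ] f (index (suc j))
      ≡⟨ cong (f ι₀ +_) (∑-↑ n (f ∘ index ∘ suc)) ⟩
    f ι₀ + (∑[ e < n ] f (ι e) + (f ι₁₂ + (f ι₃₄ + 0)))
      ≡⟨ cong (λ t → f ι₀ + (∑[ e < n ] f (ι e) + (f ι₁₂ + t))) (+-identityʳ (f ι₃₄)) ⟩
    f ι₀ + (∑[ e < n ] f (ι e) + (f ι₁₂ + f ι₃₄)) ∎
    where open ≡-Reasoning

  toℕ-ι : ∀ e → toℕ (ι e) ≡ suc (toℕ e)
  toℕ-ι e = trans (toℕ-cast _ _) (cong suc (toℕ-↑ˡ e 2))

  toℕ-ι₀ : toℕ ι₀ ≡ 0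
  toℕ-ι₀ = toℕ-cast _ 0F

  toℕ-ι₁₂ : toℕ ι₁₂ ≡ suc n
  toℕ-ι₁₂ = trans (toℕ-cast _ _) (cong suc (trans (toℕ-↑ʳ n 0F) (+-identityʳ n)))

  toℕ-ι₃₄ : toℕ ι₃₄ ≡ 2 + n
  toℕ-ι₃₄ = trans (toℕ-cast _ _) (cong suc (trans (toℕ-↑ʳ n 1F) (+-comm n 1)))

  toℕ-ι≡ : ∀ {e j k} → toℕ j ≡ k → ι e ≡ j → suc (toℕ e) ≡ k
  toℕ-ι≡ {e} toℕj≡k refl = trans (sym (toℕ-ι e)) toℕj≡k

  ι-injective : ∀ {e e′} → ι e ≡ ι e′ → e ≡ e′
  ι-injective {e′ = e′} = toℕ-injective ∘ suc-injective ∘ toℕ-ι≡ (toℕ-ι e′)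

  ι₀≢ι : ∀ e → ι₀ ≢ ι e
  ι₀≢ι e = 0≢1+n ∘ sym ∘ toℕ-ι≡ toℕ-ι₀ ∘ sym

  ι≢ι₁₂ : ∀ e → ι e ≢ ι₁₂
  ι≢ι₁₂ e = <⇒≢ (toℕ<n e) ∘ suc-injective ∘ toℕ-ι≡ toℕ-ι₁₂

  ι≢ι₃₄ : ∀ e → ι e ≢ ι₃₄
  ι≢ι₃₄ e = <⇒≢ (m<n⇒m<1+n (toℕ<n e)) ∘ suc-injective ∘ toℕ-ι≡ toℕ-ι₃₄

  ∈F-ι₀ : ∀ {x} → x ∈ F n ι₀
  ∈F-ι₀ = from (∈F⇔ toℕ-ι₀ refl) _

  ∈F-ι⇔ : ∀ {e x} → x ∈ F n (ι e) ⇔ x ≢ e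
  ∈F-ι⇔ {e} {x} = mk⇔
    (λ x∈ → to T-not-≡ᵇ⇔≢ (to ∈Fιe⇔ x∈) ∘ cong toℕ)
    (λ x≢e → from ∈Fιe⇔ (from T-not-≡ᵇ⇔≢ (x≢e ∘ toℕ-injective)))
    where
    ∈Fιe⇔ : x ∈ F n (ι e) ⇔ T (not (toℕ x ≡ᵇ toℕ e))
    ∈Fιe⇔ = ∈F⇔ (toℕ-ι e) (inF-single (suc (toℕ x)) (toℕ<n e))

module Tournament (m : ℕ) (S : Fin (4 + m + 3) → Subset (4 + m)) (reimer : Reimer S (F (4 + m)))
  where

  n : ℕ
  n = 4 + m

  open Family n public

  ∈F-ι₁₂⇔ : ∀ {x} → x ∈ F n ι₁₂ ⇔ (x ≢ 0F × x ≢ 1F)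
  ∈F-ι₁₂⇔ {x} = ⇔-trans (∈F⇔ {i = ι₁₂} toℕ-ι₁₂ (inF-pair₁₂ n (suc (toℕ x)))) (T-not-0∨1⇔ x)

  ∈F-ι₃₄⇔ : ∀ {x} → x ∈ F n ι₃₄ ⇔ (x ≢ 2F × x ≢ 3F)
  ∈F-ι₃₄⇔ {x} = ⇔-trans (∈F⇔ {i = ι₃₄} toℕ-ι₃₄ (inF-pair₃₄ n (suc (toℕ x)))) (T-not-2∨3⇔ x)

  ι₀-full : ∀ x → x ∈ S ι₀
  ι₀-full x = Reimer⇒∈ reimer (ι₀≢ι x) (λ _ → ∈F-ι₀) (λ _ → from ∈F-ι⇔)

  ordered-pair : ∀ {e e′} → e ≢ e′ → e′ ∈ S (ι e) ⊎ e ∈ S (ι e′)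
  ordered-pair e≢e′ = Reimer⇒∈⊎∈ reimer (e≢e′ ∘ ι-injective) (from ∈F-ι⇔) (from ∈F-ι⇔)

  mutual-pair : ∀ {j a b} → (∀ e → ι e ≢ j) → (∀ {x} → x ∈ F n j ⇔ (x ≢ a × x ≢ b)) →
    b ∈ S (ι a) × a ∈ S (ι b)
  mutual-pair {j} {a} {b} ι≢j ∈Fj⇔ =
    Reimer⇒∈ reimer (ι≢j a) (Fj⊆Fι proj₁) (λ x∈ x≢b → from ∈Fj⇔ (to ∈F-ι⇔ x∈ , x≢b)) ,
    Reimer⇒∈ reimer (ι≢j b) (Fj⊆Fι proj₂) (λ x∈ x≢a → from ∈Fj⇔ (x≢a , to ∈F-ι⇔ x∈))
    where
    Fj⊆Fι : ∀ {c} → (∀ {x} → x ≢ a × x ≢ b → x ≢ c) → F n j ⊆ F n (ι c)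
    Fj⊆Fι avoids-c x∈Fj = from ∈F-ι⇔ (avoids-c (to ∈Fj⇔ x∈Fj))

  pair₁₂ : 1F ∈ S (ι 0F) × 0F ∈ S (ι 1F)
  pair₁₂ = mutual-pair ι≢ι₁₂ ∈F-ι₁₂⇔

  pair₃₄ : 3F ∈ S (ι 2F) × 2F ∈ S (ι 3F)
  pair₃₄ = mutual-pair ι≢ι₃₄ ∈F-ι₃₄⇔

  incidence : Fin n → Fin n → ℕ
  incidence e e′ = 𝟙 (e′ ∈? S (ι e))

  -- The diagonal term makes every weight positive while adding only n to the total.
  weight : Fin n → Fin n → ℕ
  weight e e′ = 𝟙 (e ≟ e′) + (incidence e e′ + incidence e′ e)

  weight-pos : ∀ e e′ → 1 ≤ weight e e′
  weight-pos e e′ with e ≟ e′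
  ... | yes _    = s≤s z≤n
  ... | no e≢e′ with ordered-pair e≢e′
  ...   | inj₁ e′∈ rewrite 𝟙-yes {P? = e′ ∈? S (ι e)} e′∈ = s≤s z≤n
  ...   | inj₂ e∈  rewrite 𝟙-yes {P? = e ∈? S (ι e′)} e∈  = m≤n+m 1 (incidence e e′)

  weight-mutual : ∀ {e e′} → e′ ∈ S (ι e) → e ∈ S (ι e′) → 2 ≤ weight e e′
  weight-mutual {e} {e′} e′∈ e∈
    rewrite 𝟙-yes {P? = e′ ∈? S (ι e)} e′∈ | 𝟙-yes {P? = e ∈? S (ι e′)} e∈ = m≤n+m 2 (𝟙 (e ≟ e′))

  row-≥ : ∀ e → n ≤ ∑[ e′ < n ] weight e e′
  row-≥ e = subst (_≤ ∑[ e′ < n ] weight e e′) (∑-one n) (∑-mono-≤ (weight-pos e))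

  row-> : ∀ {e e′} → e′ ∈ S (ι e) → e ∈ S (ι e′) → n < ∑[ e″ < n ] weight e e″
  row-> {e} {e′} e′∈ e∈ =
    subst (_< ∑[ e″ < n ] weight e e″) (∑-one n) (∑-mono-< e′ (weight-pos e) (weight-mutual e′∈ e∈))

  bonus : Fin n → ℕ
  bonus 0F                        = 1
  bonus 1F                        = 1
  bonus 2F                        = 1
  bonus 3F                        = 1
  bonus (suc (suc (suc (suc _)))) = 0

  ∑-bonus : ∑[ e < n ] bonus e ≡ 4
  ∑-bonus = cong (4 +_) (sum-replicate-zero m)

  row-bound : ∀ e → bonus e + n ≤ ∑[ e′ < n ] weight e e′
  row-bound 0F                          = row-> (proj₁ pair₁₂) (proj₂ pair₁₂)
  row-bound 1F                          = row-> (proj₂ pair₁₂) (proj₁ pair₁₂)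
  row-bound 2F                          = row-> (proj₁ pair₃₄) (proj₂ pair₃₄)
  row-bound 3F                          = row-> (proj₂ pair₃₄) (proj₁ pair₃₄)
  row-bound e@(suc (suc (suc (suc _)))) = row-≥ e

  ∑∣Sι∣ : ℕ
  ∑∣Sι∣ = ∑[ e < n ] ∣ S (ι e) ∣

  tournament-bound : 4 + n * n ≤ n + (∑∣Sι∣ + ∑∣Sι∣)
  tournament-bound = begin
    4 + n * n                           ≡⟨ cong₂ _+_ ∑-bonus (∑-const n n) ⟨
    ∑[ e < n ] bonus e + ∑[ e < n ] n   ≡⟨ ∑-distrib-+ bonus (λ _ → n) ⟨
    ∑[ e < n ] (bonus e + n)            ≤⟨ ∑-mono-≤ row-bound ⟩
    ∑[ e < n ] ∑[ e′ < n ] weight e e′  ≡⟨ ∑∑-symmetrised incidence ⟩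
    n + (∑∑incidence + ∑∑incidence)     ≡⟨ cong (λ t → n + (t + t)) ∑∑incidence≡∑∣Sι∣ ⟩
    n + (∑∣Sι∣ + ∑∣Sι∣)                 ∎
    where
    open ≤-Reasoning
    ∑∑incidence : ℕ
    ∑∑incidence = ∑[ e < n ] ∑[ e′ < n ] incidence e e′
    ∑∑incidence≡∑∣Sι∣ : ∑∑incidence ≡ ∑∣Sι∣
    ∑∑incidence≡∑∣Sι∣ = sum-cong-≗ (sym ∘ ∣p∣≡∑𝟙∈ ∘ S ∘ ι)

  n≤∣Sι₀∣ : n ≤ ∣ S ι₀ ∣
  n≤∣Sι₀∣ = subst (_≤ ∣ S ι₀ ∣) (∣⊤∣≡n n) (p⊆q⇒∣p∣≤∣q∣ {p = ⊤} (λ {x} _ → ι₀-full x))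

counts⇒4x+4≤n : ∀ {n x s₀ Q a b} → n + 2 * (s₀ + (Q + (a + b))) ≤ n * (n + 3) → n ≤ s₀ →
  4 + n * n ≤ n + (Q + Q) → x ≤ a → x ≤ b → 4 * x + 4 ≤ n
counts⇒4x+4≤n {n} {x} {s₀} {Q} {a} {b} degrees n≤s₀ pairs x≤a x≤b =
  +-cancelˡ-≤ (n * (n + 3)) (4 * x + 4) n (begin
    n * (n + 3) + (4 * x + 4)
      ≡⟨ lhs n x ⟩
    (4 + n * n) + ((x + x) + (x + x)) + ((n + n) + n)
      ≤⟨ +-mono-≤ (+-mono-≤ pairs x's≤a,b) (+-monoˡ-≤ n (+-mono-≤ n≤s₀ n≤s₀)) ⟩
    (n + (Q + Q)) + ((a + a) + (b + b)) + ((s₀ + s₀) + n)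
      ≡⟨ rhs n s₀ Q a b ⟩
    n + 2 * (s₀ + (Q + (a + b))) + n
      ≤⟨ +-monoˡ-≤ n degrees ⟩
    n * (n + 3) + n ∎)
  where
  open ≤-Reasoning
  x's≤a,b : (x + x) + (x + x) ≤ (a + a) + (b + b)
  x's≤a,b = +-mono-≤ (+-mono-≤ x≤a x≤a) (+-mono-≤ x≤b x≤b)
  lhs : ∀ n x → n * (n + 3) + (4 * x + 4) ≡ (4 + n * n) + ((x + x) + (x + x)) + ((n + n) + n)
  lhs = solve-∀
  rhs : ∀ n s₀ Q a b →
    (n + (Q + Q)) + ((a + a) + (b + b)) + ((s₀ + s₀) + n) ≡ n + 2 * (s₀ + (Q + (a + b))) + n
  rhs = solve-∀

mainTheorem6 : (n : ℕ) → 4 ≤ n → 2 ∣ n →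
    (S : Fin (n + 3) → Subset n) →
    Injective _≡_ _≡_ S →
    Reimer S (F n) →
    ¬ Abundant S →
    (x : ℕ) → (∃ λ i → ∣ S i ∣ ≡ x) → (∀ i → x ≤ ∣ S i ∣) →
    4 * x + 4 ≤ n
mainTheorem6 _ (s≤s (s≤s (s≤s (s≤s (z≤n {m}))))) _ S _ reimer ¬abundant x _ x≤ =
  counts⇒4x+4≤n {Q = ∑∣Sι∣} degrees n≤∣Sι₀∣ tournament-bound (x≤ ι₁₂) (x≤ ι₃₄)
  where
  open Tournament m S reimer
  degrees : n + 2 * (∣ S ι₀ ∣ + (∑∣Sι∣ + (∣ S ι₁₂ ∣ + ∣ S ι₃₄ ∣))) ≤ n * (n + 3)
  degrees = subst (λ D → n + 2 * D ≤ n * (n + 3))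
                  (trans (∑-degree S) (∑-indices (λ i → ∣ S i ∣)))
                  (¬Abundant⇒∑degree≤ S ¬abundant)
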